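{- There is a universal constant $c$ such that for every $n\ge1$, $\chi(\mathbb{Q}_{3}^{n},1)\le c\,(\sqrt[3]{9})^{n}$. The same remains true if $\mathbb{Q}_{3}$ is replaced by any subring of $\mathbb{R}$ admitting a ring homomorphism to $\mathbb{Z}_{3}$.
   Context: $\mathbb{Q}_{3}$ denotes the ring of rational numbers whose reduced denominators are coprime to $3$; $\mathbb{Z}_{3}=\mathbb{Z}/3\mathbb{Z}$. For a metric space $M$ and $d>0$, $\chi(M,d)$ is the minimal cardinality of a set $S$ for which there is a map $f:M\to S$ with $f(x)\neq f(y)$ whenever the distance between $x$ and $y$ equals $d$. Subsets of $\mathbb{R}^{n}$ carry the Euclidean metric. -}

module Defs where

open import Level using (0ℓ)
open import Data.Nat as ℕ using (ℕ; zero; suc)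
open import Data.Nat.Divisibility using (_∣_)
open import Data.Nat.DivMod using (_mod_)
open import Data.Fin using (Fin; zero; suc; toℕ)
open import Data.Rational as ℚ using (ℚ; 1ℚ; 0ℚ)
open import Data.Product using (Σ; _×_; _,_; proj₁)
open import Relation.Nullary using (¬_)
open import Relation.Binary.PropositionalEquality using (_≡_; _≢_)
open import Algebra.Bundles using (CommutativeRing)
open import Data.Sum using (_⊎_)

-- ℚ₃ : rationals whose reduced denominator is coprime to 3
-- (3 prime, so: 3 does not divide the reduced denominator).
-- ℚ's representation in the stdlib is always reduced.

IsQ₃ : ℚ → Set
IsQ₃ q = ¬ (3 ∣ ℚ.denominatorℕ q)

Q₃ : Set
Q₃ = Σ ℚ IsQ₃

sumℚ : (n : ℕ) → (Fin n → ℚ) → ℚ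
sumℚ zero    f = 0ℚ
sumℚ (suc n) f = f zero ℚ.+ sumℚ n (λ i → f (suc i))

UnitDistQ₃ : (n : ℕ) → (Fin n → Q₃) → (Fin n → Q₃) → Set
UnitDistQ₃ n x y =
  sumℚ n (λ i → (proj₁ (x i) ℚ.- proj₁ (y i)) ℚ.* (proj₁ (x i) ℚ.- proj₁ (y i))) ≡ 1ℚ

ColouringQ₃ : (n k : ℕ) → Set
ColouringQ₃ n k =
  Σ ((Fin n → Q₃) → Fin k) λ f →
    ∀ x y → UnitDistQ₃ n x y → f x ≢ f y


ℤ₃ : Set
ℤ₃ = Fin 3

_+₃_ : ℤ₃ → ℤ₃ → ℤ₃
a +₃ b = (toℕ a ℕ.+ toℕ b) mod 3

_*₃_ : ℤ₃ → ℤ₃ → ℤ₃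
a *₃ b = (toℕ a ℕ.* toℕ b) mod 3

record RingHomToℤ₃ (R : CommutativeRing 0ℓ 0ℓ) : Set where
  open CommutativeRing R using (Carrier; _≈_; _+_; _*_; _-_; 0#; 1#)
  field
    φ      : Carrier → ℤ₃
    φ-cong : ∀ {x y} → x ≈ y → φ x ≡ φ y
    φ-+    : ∀ x y → φ (x + y) ≡ φ x +₃ φ y
    φ-*    : ∀ x y → φ (x * y) ≡ φ x *₃ φ y
    φ-1    : φ 1# ≡ suc zero

-- The stdlib has no ℝ; a commutative ring is (isomorphic
-- to) a subring of ℝ iff it is nontrivial and carries an archimedean
-- total ring ordering.

ofℕ : {R : CommutativeRing 0ℓ 0ℓ} → ℕ → CommutativeRing.Carrier R
ofℕ {R} zero    = CommutativeRing.0# R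
ofℕ {R} (suc m) = CommutativeRing._+_ R (CommutativeRing.1# R) (ofℕ {R} m)

record ArchimedeanOrdered (R : CommutativeRing 0ℓ 0ℓ) : Set₁ where
  open CommutativeRing R using (Carrier; _≈_; _+_; _*_; _-_; 0#; 1#)
  field
    _≤_       : Carrier → Carrier → Set
    ≤-resp    : ∀ {x x′ y y′} → x ≈ x′ → y ≈ y′ → x ≤ y → x′ ≤ y′
    ≤-refl    : ∀ {x} → x ≤ x
    ≤-trans   : ∀ {x y z} → x ≤ y → y ≤ z → x ≤ z
    ≤-antisym : ∀ {x y} → x ≤ y → y ≤ x → x ≈ y
    ≤-total   : ∀ x y → (x ≤ y) ⊎ (y ≤ x)
    +-mono    : ∀ {x y} z → x ≤ y → (x + z) ≤ (y + z)
    *-nonneg  : ∀ {x y} → 0# ≤ x → 0# ≤ y → 0# ≤ (x * y)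
    nontrivial : ¬ (1# ≈ 0#)
    archimedean : ∀ x → Σ ℕ λ m → x ≤ ofℕ {R} m

module _ (R : CommutativeRing 0ℓ 0ℓ) where
  open CommutativeRing R using (Carrier; _≈_; _+_; _*_; _-_; 0#; 1#)

  sumR : (n : ℕ) → (Fin n → Carrier) → Carrier
  sumR zero    f = 0#
  sumR (suc n) f = f zero + sumR n (λ i → f (suc i))

  UnitDistR : (n : ℕ) → (Fin n → Carrier) → (Fin n → Carrier) → Set
  UnitDistR n x y = sumR n (λ i → (x i - y i) * (x i - y i)) ≈ 1#

  ColouringR : (n k : ℕ) → Set
  ColouringR n k =
    Σ ((Fin n → Carrier) → Fin k) λ f →
      (∀ x y → (∀ i → x i ≈ y i) → f x ≡ f y) ×
      (∀ x y → UnitDistR n x y → f x ≢ f y)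

{-# OPTIONS --safe #-}
module Submission where

-- Both rings reduce onto ℤ₃: for ℚ₃ send a/b to a·b mod 3, which is a/b mod 3
-- because b² ≡ 1 (mod 3).  Split the n coordinates into blocks of three and colour a
-- point by the pair (x₀ - x₂, x₁ - x₂) of reduced differences in each block; a
-- trailing block of one or two coordinates is coloured by its reductions.  This uses
-- at most 3 · 9^(n/3) colours.  If two points get the same colour, their reduced
-- coordinate differences are constant on each block, so the reduced squared distance
-- is a sum of terms 3e² = 0, whereas a squared distance 1 reduces to 1.

open import Defs
open import Level using (0ℓ)
open import Data.Nat as ℕ using (ℕ; zero; suc)
open import Data.Fin using (Fin; zero; suc; combine; _↑ʳ_)
open import Data.Fin.Properties using (all?; _≟_; combine-injective)
open import Data.Vec.Functional using (drop)
open import Data.Product using (Σ; _×_; _,_; proj₁)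
open import Function using (_∘_)
open import Relation.Nullary.Decidable using (from-yes; _→-dec_)
open import Relation.Binary.PropositionalEquality
open import Algebra.Bundles using (CommutativeRing)

neg₃ : ℤ₃ → ℤ₃
neg₃ zero             = zero
neg₃ (suc zero)       = suc (suc zero)
neg₃ (suc (suc zero)) = suc zero

infixl 6 _-₃_
_-₃_ : ℤ₃ → ℤ₃ → ℤ₃
x -₃ y = x +₃ neg₃ y

sq₃ : ℤ₃ → ℤ₃
sq₃ x = x *₃ x

sqDist₃ : (n : ℕ) → (Fin n → ℤ₃) → (Fin n → ℤ₃) → ℤ₃
sqDist₃ zero    a b = zero
sqDist₃ (suc n) a b = sq₃ (a zero -₃ b zero) +₃ sqDist₃ n (a ∘ suc) (b ∘ suc)

x-₃x≡0 : ∀ x → x -₃ x ≡ zero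
x-₃x≡0 = from-yes (all? λ x → x -₃ x ≟ zero)

x+₃x+₃x+₃y≡y : ∀ x y → x +₃ (x +₃ (x +₃ y)) ≡ y
x+₃x+₃x+₃y≡y = from-yes (all? λ x → all? λ y → x +₃ (x +₃ (x +₃ y)) ≟ y)

x-₃z≡y-₃w⇒x-₃y≡z-₃w : ∀ x y z w → x -₃ z ≡ y -₃ w → x -₃ y ≡ z -₃ w
x-₃z≡y-₃w⇒x-₃y≡z-₃w = from-yes (all? λ x → all? λ y → all? λ z → all? λ w →
  (x -₃ z ≟ y -₃ w) →-dec (x -₃ y ≟ z -₃ w))

x≡x+₃x⇒x≡0 : ∀ x → x ≡ x +₃ x → x ≡ zero
x≡x+₃x⇒x≡0 = from-yes (all? λ x → (x ≟ x +₃ x) →-dec (x ≟ zero))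

x+₃y≡0⇒y≡neg₃x : ∀ x y → x +₃ y ≡ zero → y ≡ neg₃ x
x+₃y≡0⇒y≡neg₃x = from-yes (all? λ x → all? λ y → (x +₃ y ≟ zero) →-dec (y ≟ neg₃ x))

sqDist₃-≗ : ∀ n (a b : Fin n → ℤ₃) → (∀ i → a i ≡ b i) → sqDist₃ n a b ≡ zero
sqDist₃-≗ zero    a b a≗b = refl
sqDist₃-≗ (suc n) a b a≗b =
  cong₂ (λ d s → sq₃ d +₃ s)
        (trans (cong (_-₃ b zero) (a≗b zero)) (x-₃x≡0 (b zero)))
        (sqDist₃-≗ n (a ∘ suc) (b ∘ suc) (a≗b ∘ suc))

colourCount : ℕ → ℕ
colourCount 0                   = 1
colourCount 1                   = 3
colourCount 2                   = 9
colourCount (suc (suc (suc n))) = 9 ℕ.* colourCount n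

blockColour : ℤ₃ → ℤ₃ → ℤ₃ → Fin 9
blockColour x y z = combine (x -₃ z) (y -₃ z)

blockColour-≡ : ∀ x y z x′ y′ z′ → blockColour x y z ≡ blockColour x′ y′ z′ →
                x -₃ x′ ≡ z -₃ z′ × y -₃ y′ ≡ z -₃ z′
blockColour-≡ x y z x′ y′ z′ eq
  with combine-injective (x -₃ z) (y -₃ z) (x′ -₃ z′) (y′ -₃ z′) eq
... | eqˣ , eqʸ = x-₃z≡y-₃w⇒x-₃y≡z-₃w x x′ z z′ eqˣ , x-₃z≡y-₃w⇒x-₃y≡z-₃w y y′ z z′ eqʸ

colour : (n : ℕ) → (Fin n → ℤ₃) → Fin (colourCount n)
colour 0                   a = zero
colour 1                   a = a zero
colour 2                   a = combine (a zero) (a (suc zero))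
colour (suc (suc (suc n))) a =
  combine (blockColour (a zero) (a (suc zero)) (a (suc (suc zero))))
          (colour n (drop 3 a))

colour-cong : ∀ n {a b : Fin n → ℤ₃} → (∀ i → a i ≡ b i) → colour n a ≡ colour n b
colour-cong 0                   a≗b = refl
colour-cong 1                   a≗b = a≗b zero
colour-cong 2                   a≗b = cong₂ combine (a≗b zero) (a≗b (suc zero))
colour-cong (suc (suc (suc n))) {a} {b} a≗b
  rewrite a≗b zero | a≗b (suc zero) | a≗b (suc (suc zero)) =
  cong (combine (blockColour (b zero) (b (suc zero)) (b (suc (suc zero)))))
       (colour-cong n (a≗b ∘ (3 ↑ʳ_)))

colour-≡⇒sqDist₃≡0 : ∀ n (a b : Fin n → ℤ₃) → colour n a ≡ colour n b → sqDist₃ n a b ≡ zero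
colour-≡⇒sqDist₃≡0 0 a b eq = refl
colour-≡⇒sqDist₃≡0 1 a b eq = sqDist₃-≗ 1 a b λ { zero → eq }
colour-≡⇒sqDist₃≡0 2 a b eq
  with combine-injective (a zero) (a (suc zero)) (b zero) (b (suc zero)) eq
... | eq₀ , eq₁ = sqDist₃-≗ 2 a b λ { zero → eq₀ ; (suc zero) → eq₁ }
colour-≡⇒sqDist₃≡0 (suc (suc (suc n))) a b eq
  with combine-injective
         (blockColour (a zero) (a (suc zero)) (a (suc (suc zero)))) (colour n (drop 3 a))
         (blockColour (b zero) (b (suc zero)) (b (suc (suc zero)))) (colour n (drop 3 b)) eq
... | eqᴮ , eqᵀ
  with blockColour-≡ (a zero) (a (suc zero)) (a (suc (suc zero)))
                     (b zero) (b (suc zero)) (b (suc (suc zero))) eqᴮ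
...   | d₀≡d₂ , d₁≡d₂ = begin
  sq₃ d₀ +₃ (sq₃ d₁ +₃ (sq₃ d₂ +₃ rest))
    ≡⟨ cong₂ (λ u v → sq₃ u +₃ (sq₃ v +₃ (sq₃ d₂ +₃ rest))) d₀≡d₂ d₁≡d₂ ⟩
  sq₃ d₂ +₃ (sq₃ d₂ +₃ (sq₃ d₂ +₃ rest))
    ≡⟨ x+₃x+₃x+₃y≡y (sq₃ d₂) rest ⟩
  rest
    ≡⟨ colour-≡⇒sqDist₃≡0 n (drop 3 a) (drop 3 b) eqᵀ ⟩
  zero ∎
  where
  open ≡-Reasoning
  d₀ d₁ d₂ rest : ℤ₃
  d₀ = a zero -₃ b zero
  d₁ = a (suc zero) -₃ b (suc zero)
  d₂ = a (suc (suc zero)) -₃ b (suc (suc zero))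
  rest = sqDist₃ n (drop 3 a) (drop 3 b)

module _ (R : CommutativeRing 0ℓ 0ℓ) (h : RingHomToℤ₃ R) where
  open CommutativeRing R using (Carrier; _≈_; 0#; 1#; +-identityʳ; -‿inverseʳ)
    renaming (_+_ to _+ᴿ_; _*_ to _*ᴿ_; _-_ to _-ᴿ_; -_ to -ᴿ_; sym to ≈-sym)
  open RingHomToℤ₃ h

  φ-0# : φ 0# ≡ zero
  φ-0# = x≡x+₃x⇒x≡0 (φ 0#) (trans (φ-cong (≈-sym (+-identityʳ 0#))) (φ-+ 0# 0#))

  φ-neg : ∀ x → φ (-ᴿ x) ≡ neg₃ (φ x)
  φ-neg x = x+₃y≡0⇒y≡neg₃x (φ x) (φ (-ᴿ x))
    (trans (sym (φ-+ x (-ᴿ x))) (trans (φ-cong (-‿inverseʳ x)) φ-0#))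

  φ-sqDist : ∀ n (x y : Fin n → Carrier) →
             φ (sumR R n (λ i → (x i -ᴿ y i) *ᴿ (x i -ᴿ y i))) ≡ sqDist₃ n (φ ∘ x) (φ ∘ y)
  φ-sqDist zero    x y = φ-0#
  φ-sqDist (suc n) x y = begin
    φ (d *ᴿ d +ᴿ rest)     ≡⟨ φ-+ (d *ᴿ d) rest ⟩
    φ (d *ᴿ d) +₃ φ rest   ≡⟨ cong₂ _+₃_ (φ-* d d) (φ-sqDist n (x ∘ suc) (y ∘ suc)) ⟩
    sq₃ (φ d) +₃ restᶻ     ≡⟨ cong (λ e → sq₃ e +₃ restᶻ) φ-d ⟩
    sqDist₃ (suc n) (φ ∘ x) (φ ∘ y) ∎
    where
    open ≡-Reasoning
    d = x zero -ᴿ y zero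
    rest = sumR R n (λ i → (x (suc i) -ᴿ y (suc i)) *ᴿ (x (suc i) -ᴿ y (suc i)))
    restᶻ = sqDist₃ n (φ ∘ x ∘ suc) (φ ∘ y ∘ suc)
    φ-d : φ d ≡ φ (x zero) -₃ φ (y zero)
    φ-d = trans (φ-+ (x zero) (-ᴿ y zero)) (cong (φ (x zero) +₃_) (φ-neg (y zero)))

  ringColouring : ∀ n → ColouringR R n (colourCount n)
  ringColouring n = colourOf , colourOf-cong , colourOf-proper
    where
    colourOf : (Fin n → Carrier) → Fin (colourCount n)
    colourOf x = colour n (φ ∘ x)
    colourOf-cong : ∀ x y → (∀ i → x i ≈ y i) → colourOf x ≡ colourOf y
    colourOf-cong x y x≈y = colour-cong n (φ-cong ∘ x≈y)
    colourOf-proper : ∀ x y → UnitDistR R n x y → colourOf x ≢ colourOf y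
    colourOf-proper x y dist≈1 eq = 1≢0 (begin
      suc zero                         ≡⟨ φ-1 ⟨
      φ 1#                             ≡⟨ φ-cong dist≈1 ⟨
      φ (sumR R n _)                   ≡⟨ φ-sqDist n x y ⟩
      sqDist₃ n (φ ∘ x) (φ ∘ y)        ≡⟨ colour-≡⇒sqDist₃≡0 n (φ ∘ x) (φ ∘ y) eq ⟩
      zero                             ∎)
      where
      open ≡-Reasoning
      1≢0 : suc zero ≢ zero
      1≢0 ()

module FractionCongruence (p : ℕ) where
  open import Data.Nat.Primality using (Prime; euclidsLemma; prime⇒nonTrivial)
  open import Data.Nat.Coprimality using (coprime?)
  open import Data.Nat.Divisibility using () renaming (_∣_ to _∣ₙ_)
  open import Data.Nat.Base using (nonTrivial⇒≢1)
  open import Data.Integer as ℤ using (ℤ; +_; _+_; _*_; _-_; -_)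
  open import Data.Integer.Properties using (abs-*)
  open import Data.Integer.Divisibility.Signed
    using (_∣_; ∣⇒∣ᵤ; ∣ᵤ⇒∣; ∣m∣n⇒∣m+n; ∣m⇒∣-m; ∣n⇒∣m*n; ∣m⇒∣m*n)
  open import Data.Integer.Tactic.RingSolver using (solve-∀)
  open import Data.Rational as ℚ using (ℚ; toℚᵘ)
  open import Data.Rational.Properties using (toℚᵘ-homo-+; toℚᵘ-homo-*; toℚᵘ-homo‿-)
  open import Data.Rational.Unnormalised as ℚᵘ using (ℚᵘ; mkℚᵘ; ↥_; ↧_; _≃_; *≡*)
  open import Data.Rational.Unnormalised.Properties using (≃-sym)
  open import Data.Sum using (inj₁; inj₂)
  open import Relation.Nullary using (¬_; recompute; contradiction)

  infix 4 _≡ᵘ_[mod-p] _≡_[mod-p]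
  _≡ᵘ_[mod-p] : ℚᵘ → ℤ → Set
  u ≡ᵘ r [mod-p] = + p ∣ ↥ u - r * ↧ u

  p∤↧ : ℚᵘ → Set
  p∤↧ u = ¬ (+ p ∣ ↧ u)

  ≡ᵘ[mod-p]-+ : ∀ u v r s → u ≡ᵘ r [mod-p] → v ≡ᵘ s [mod-p] → u ℚᵘ.+ v ≡ᵘ r + s [mod-p]
  ≡ᵘ[mod-p]-+ (mkℚᵘ a b) (mkℚᵘ c d) r s u≡r v≡s =
    subst (+ p ∣_) (sym (identity a (+ suc b) c (+ suc d) r s))
      (∣m∣n⇒∣m+n (∣n⇒∣m*n (+ suc d) u≡r) (∣n⇒∣m*n (+ suc b) v≡s))
    where
    identity : ∀ a A c C r s →
      (a * C + c * A) - (r + s) * (A * C) ≡ C * (a - r * A) + A * (c - s * C)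
    identity = solve-∀

  ≡ᵘ[mod-p]-* : ∀ u v r s → u ≡ᵘ r [mod-p] → v ≡ᵘ s [mod-p] → u ℚᵘ.* v ≡ᵘ r * s [mod-p]
  ≡ᵘ[mod-p]-* (mkℚᵘ a b) (mkℚᵘ c d) r s u≡r v≡s =
    subst (+ p ∣_) (sym (identity a (+ suc b) c (+ suc d) r s))
      (∣m∣n⇒∣m+n (∣n⇒∣m*n c u≡r) (∣n⇒∣m*n (r * + suc b) v≡s))
    where
    identity : ∀ a A c C r s →
      a * c - (r * s) * (A * C) ≡ c * (a - r * A) + (r * A) * (c - s * C)
    identity = solve-∀

  ≡ᵘ[mod-p]-neg : ∀ u r → u ≡ᵘ r [mod-p] → ℚᵘ.- u ≡ᵘ - r [mod-p]
  ≡ᵘ[mod-p]-neg (mkℚᵘ a b) r u≡r =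
    subst (+ p ∣_) (sym (identity a (+ suc b) r)) (∣m⇒∣-m u≡r)
    where
    identity : ∀ a A r → - a - (- r) * A ≡ - (a - r * A)
    identity = solve-∀

  ≡ᵘ[mod-p]-shift : ∀ u r s → u ≡ᵘ r [mod-p] → + p ∣ r - s → u ≡ᵘ s [mod-p]
  ≡ᵘ[mod-p]-shift (mkℚᵘ a b) r s u≡r p∣r-s =
    subst (+ p ∣_) (sym (identity a (+ suc b) r s)) (∣m∣n⇒∣m+n u≡r (∣m⇒∣m*n (+ suc b) p∣r-s))
    where
    identity : ∀ a A r s → a - s * A ≡ (a - r * A) + (r - s) * A
    identity = solve-∀

  _≡_[mod-p] : ℚ → ℤ → Set
  q ≡ r [mod-p] = toℚᵘ q ≡ᵘ r [mod-p]

  module _ (p-prime : Prime p) where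

    p∣m*n⇒p∤m⇒p∣n : ∀ m n → + p ∣ m * n → ¬ (+ p ∣ m) → + p ∣ n
    p∣m*n⇒p∤m⇒p∣n m n p∣mn p∤m
      with euclidsLemma ℤ.∣ m ∣ ℤ.∣ n ∣ p-prime (subst (p ∣ₙ_) (abs-* m n) (∣⇒∣ᵤ p∣mn))
    ... | inj₁ p∣m = contradiction (∣ᵤ⇒∣ p∣m) p∤m
    ... | inj₂ p∣n = ∣ᵤ⇒∣ p∣n

    p∤↧-* : ∀ u v → p∤↧ u → p∤↧ v → p∤↧ (u ℚᵘ.* v)
    p∤↧-* (mkℚᵘ a b) (mkℚᵘ c d) p∤↧u p∤↧v p∣↧uv =
      p∤↧v (p∣m*n⇒p∤m⇒p∣n (+ suc b) (+ suc d) p∣↧uv p∤↧u)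

    -- ↧ (u + v) and ↧ (u * v) are both ↧ u * ↧ v
    p∤↧-+ : ∀ u v → p∤↧ u → p∤↧ v → p∤↧ (u ℚᵘ.+ v)
    p∤↧-+ (mkℚᵘ a b) (mkℚᵘ c d) = p∤↧-* (mkℚᵘ a b) (mkℚᵘ c d)

    p∤↧-neg : ∀ u → p∤↧ u → p∤↧ (ℚᵘ.- u)
    p∤↧-neg (mkℚᵘ a b) p∤↧u = p∤↧u

    ≡ᵘ[mod-p]-resp-≃ : ∀ u v r → p∤↧ u → u ≃ v → u ≡ᵘ r [mod-p] → v ≡ᵘ r [mod-p]
    ≡ᵘ[mod-p]-resp-≃ (mkℚᵘ a b) (mkℚᵘ c d) r p∤↧u (*≡* ad≡cb) u≡r =
      p∣m*n⇒p∤m⇒p∣n (+ suc b) _ (subst (+ p ∣_) (cross-multiply r a (+ suc b) c (+ suc d) ad≡cb)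
                                   (∣n⇒∣m*n (+ suc d) u≡r)) p∤↧u
      where
      cross-multiply : ∀ r a A c C → a * C ≡ c * A → C * (a - r * A) ≡ A * (c - r * C)
      cross-multiply r a A c C aC≡cA = begin
        C * (a - r * A)      ≡⟨ expand r a A C ⟩
        a * C - r * A * C    ≡⟨ cong (λ t → t - r * A * C) aC≡cA ⟩
        c * A - r * A * C    ≡⟨ collect r c A C ⟩
        A * (c - r * C)      ∎
        where
        open ≡-Reasoning
        expand : ∀ r a A C → C * (a - r * A) ≡ a * C - r * A * C
        expand = solve-∀
        collect : ∀ r c A C → c * A - r * A * C ≡ A * (c - r * C)
        collect = solve-∀

    -- a common factor p of ↥ q and ↧ q would contradict that q is in lowest terms
    ≡[mod-p]⇒p∤↧ : ∀ q r → q ≡ r [mod-p] → p∤↧ (toℚᵘ q)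
    ≡[mod-p]⇒p∤↧ (ℚ.mkℚ a d coprime) r q≡r p∣↧q =
      nonTrivial⇒≢1 {{prime⇒nonTrivial p-prime}}
        (recompute (coprime? ℤ.∣ a ∣ (suc d)) coprime (∣⇒∣ᵤ p∣a , ∣⇒∣ᵤ p∣↧q))
      where
      regroup : ∀ a A r → a ≡ (a - r * A) + r * A
      regroup = solve-∀
      p∣a : + p ∣ a
      p∣a = subst (+ p ∣_) (sym (regroup a (+ suc d) r)) (∣m∣n⇒∣m+n q≡r (∣n⇒∣m*n r p∣↧q))

    ≡[mod-p]-+ : ∀ q q′ r s → q ≡ r [mod-p] → q′ ≡ s [mod-p] → q ℚ.+ q′ ≡ r + s [mod-p]
    ≡[mod-p]-+ q q′ r s q≡r q′≡s =
      ≡ᵘ[mod-p]-resp-≃ _ (toℚᵘ (q ℚ.+ q′)) (r + s)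
        (p∤↧-+ (toℚᵘ q) (toℚᵘ q′) (≡[mod-p]⇒p∤↧ q r q≡r) (≡[mod-p]⇒p∤↧ q′ s q′≡s))
        (≃-sym (toℚᵘ-homo-+ q q′)) (≡ᵘ[mod-p]-+ (toℚᵘ q) (toℚᵘ q′) r s q≡r q′≡s)

    ≡[mod-p]-* : ∀ q q′ r s → q ≡ r [mod-p] → q′ ≡ s [mod-p] → q ℚ.* q′ ≡ r * s [mod-p]
    ≡[mod-p]-* q q′ r s q≡r q′≡s =
      ≡ᵘ[mod-p]-resp-≃ _ (toℚᵘ (q ℚ.* q′)) (r * s)
        (p∤↧-* (toℚᵘ q) (toℚᵘ q′) (≡[mod-p]⇒p∤↧ q r q≡r) (≡[mod-p]⇒p∤↧ q′ s q′≡s))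
        (≃-sym (toℚᵘ-homo-* q q′)) (≡ᵘ[mod-p]-* (toℚᵘ q) (toℚᵘ q′) r s q≡r q′≡s)

    ≡[mod-p]-neg : ∀ q r → q ≡ r [mod-p] → ℚ.- q ≡ - r [mod-p]
    ≡[mod-p]-neg q r q≡r =
      ≡ᵘ[mod-p]-resp-≃ _ (toℚᵘ (ℚ.- q)) (- r) (p∤↧-neg (toℚᵘ q) (≡[mod-p]⇒p∤↧ q r q≡r))
        (≃-sym (toℚᵘ-homo‿- q)) (≡ᵘ[mod-p]-neg (toℚᵘ q) r q≡r)

module RationalReduction where
  open import Data.Nat.Primality using (Prime; prime?)
  open import Data.Fin using (toℕ; fromℕ<)
  open import Data.Fin.Properties using (toℕ-fromℕ<)
  open import Data.Integer using (ℤ; +_; _+_; _*_; _-_; -_)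
  open import Data.Integer.Properties using (+-identityʳ)
  open import Data.Integer.DivMod using (_%ℕ_; _/ℕ_; n%ℕd<d; a≡a%ℕn+[a/ℕn]*n)
  open import Data.Integer.Divisibility.Signed
    using (_∣_; _∣?_; divides; ∣⇒∣ᵤ; ∣m∣n⇒∣m+n; ∣n⇒∣m*n; ∣m⇒∣m*n)
  open import Data.Integer.Tactic.RingSolver using (solve-∀)
  open import Data.Rational as ℚ using (ℚ; 1ℚ)
  open import Data.Rational.Unnormalised using (mkℚᵘ)
  open import Relation.Nullary using (¬_; ¬?)
  open import Relation.Nullary.Decidable using (from-no)

  open FractionCongruence 3

  prime-3 : Prime 3
  prime-3 = from-yes (prime? 3)

  ι : ℤ₃ → ℤ
  ι x = + toℕ x

  residue₃ : ℤ → ℤ₃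
  residue₃ z = fromℕ< (n%ℕd<d z 3)

  3∣z-residue₃z : ∀ z → + 3 ∣ z - ι (residue₃ z)
  3∣z-residue₃z z rewrite toℕ-fromℕ< (n%ℕd<d z 3) =
    divides (z /ℕ 3) (trans (cong (_- + (z %ℕ 3)) (a≡a%ℕn+[a/ℕn]*n z 3))
                            (cancel (+ (z %ℕ 3)) (z /ℕ 3)))
    where
    cancel : ∀ r q → (r + q * + 3) - r ≡ q * + 3
    cancel = solve-∀

  ι-+₃ : ∀ x y → + 3 ∣ (ι x + ι y) - ι (x +₃ y)
  ι-+₃ = from-yes (all? λ x → all? λ y → + 3 ∣? (ι x + ι y) - ι (x +₃ y))

  ι-*₃ : ∀ x y → + 3 ∣ (ι x * ι y) - ι (x *₃ y)
  ι-*₃ = from-yes (all? λ x → all? λ y → + 3 ∣? (ι x * ι y) - ι (x *₃ y))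

  ι-neg₃ : ∀ x → + 3 ∣ - ι x - ι (neg₃ x)
  ι-neg₃ = from-yes (all? λ x → + 3 ∣? - ι x - ι (neg₃ x))

  x≢0⇒3∣1-ιx*ιx : ∀ x → x ≢ zero → + 3 ∣ + 1 - ι x * ι x
  x≢0⇒3∣1-ιx*ιx = from-yes (all? λ x → ¬? (x ≟ zero) →-dec (+ 3 ∣? + 1 - ι x * ι x))

  3∤z⇒3∣1-z*z : ∀ z → ¬ (+ 3 ∣ z) → + 3 ∣ + 1 - z * z
  3∤z⇒3∣1-z*z z 3∤z = subst (+ 3 ∣_) (sym (split z (ι r)))
    (∣m∣n⇒∣m+n (x≢0⇒3∣1-ιx*ιx r r≢0) (∣m⇒∣m*n (- (ι r + z)) (3∣z-residue₃z z)))
    where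
    r = residue₃ z
    split : ∀ z s → + 1 - z * z ≡ (+ 1 - s * s) + (z - s) * - (s + z)
    split = solve-∀
    r≢0 : r ≢ zero
    r≢0 r≡0 = 3∤z (subst (+ 3 ∣_) (+-identityʳ z)
                         (subst (λ t → + 3 ∣ z - ι t) r≡0 (3∣z-residue₃z z)))

  infix 4 _↦₃_
  _↦₃_ : ℚ → ℤ₃ → Set
  q ↦₃ x = q ≡ ι x [mod-p]

  ↦₃-+ : ∀ q q′ x y → q ↦₃ x → q′ ↦₃ y → q ℚ.+ q′ ↦₃ x +₃ y
  ↦₃-+ q q′ x y q↦x q′↦y =
    ≡ᵘ[mod-p]-shift (ℚ.toℚᵘ (q ℚ.+ q′)) (ι x + ι y) (ι (x +₃ y))
      (≡[mod-p]-+ prime-3 q q′ (ι x) (ι y) q↦x q′↦y) (ι-+₃ x y)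

  ↦₃-* : ∀ q q′ x y → q ↦₃ x → q′ ↦₃ y → q ℚ.* q′ ↦₃ x *₃ y
  ↦₃-* q q′ x y q↦x q′↦y =
    ≡ᵘ[mod-p]-shift (ℚ.toℚᵘ (q ℚ.* q′)) (ι x * ι y) (ι (x *₃ y))
      (≡[mod-p]-* prime-3 q q′ (ι x) (ι y) q↦x q′↦y) (ι-*₃ x y)

  ↦₃-neg : ∀ q x → q ↦₃ x → ℚ.- q ↦₃ neg₃ x
  ↦₃-neg q x q↦x =
    ≡ᵘ[mod-p]-shift (ℚ.toℚᵘ (ℚ.- q)) (- ι x) (ι (neg₃ x))
      (≡[mod-p]-neg prime-3 q (ι x) q↦x) (ι-neg₃ x)

  ↦₃-sqDist : ∀ n (x y : Fin n → ℚ) (a b : Fin n → ℤ₃) →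
              (∀ i → x i ↦₃ a i) → (∀ i → y i ↦₃ b i) →
              sumℚ n (λ i → (x i ℚ.- y i) ℚ.* (x i ℚ.- y i)) ↦₃ sqDist₃ n a b
  ↦₃-sqDist zero    x y a b x↦a y↦b = divides (+ 0) refl
  ↦₃-sqDist (suc n) x y a b x↦a y↦b =
    ↦₃-+ (d ℚ.* d) _ (sq₃ e) (sqDist₃ n (a ∘ suc) (b ∘ suc)) (↦₃-* d d e e d↦e d↦e)
      (↦₃-sqDist n (x ∘ suc) (y ∘ suc) (a ∘ suc) (b ∘ suc) (x↦a ∘ suc) (y↦b ∘ suc))
    where
    d = x zero ℚ.- y zero
    e = a zero -₃ b zero
    d↦e : d ↦₃ e
    d↦e = ↦₃-+ (x zero) (ℚ.- y zero) (a zero) (neg₃ (b zero))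
                (x↦a zero) (↦₃-neg (y zero) (b zero) (y↦b zero))

  ¬1ℚ↦₃0 : ¬ (1ℚ ↦₃ zero)
  ¬1ℚ↦₃0 = from-no (+ 3 ∣? + 1)

  reduce₃ : Q₃ → ℤ₃
  reduce₃ (q , _) = residue₃ (ℚ.↥ q * ℚ.↧ q)

  -- ↧ q ≡ ±1 (mod 3), hence ↥ q / ↧ q ≡ ↥ q · ↧ q
  reduce₃-↦₃ : ∀ x → proj₁ x ↦₃ reduce₃ x
  reduce₃-↦₃ (ℚ.mkℚ a d _ , 3∤↧) =
    ≡ᵘ[mod-p]-shift (mkℚᵘ a d) (a * + suc d) (ι (residue₃ (a * + suc d)))
      (subst (+ 3 ∣_) (sym (factor a (+ suc d)))
             (∣n⇒∣m*n a (3∤z⇒3∣1-z*z (+ suc d) (3∤↧ ∘ ∣⇒∣ᵤ))))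
      (3∣z-residue₃z (a * + suc d))
    where
    factor : ∀ a D → a - (a * D) * D ≡ a * (+ 1 - D * D)
    factor = solve-∀

  rationalColouring : ∀ n → ColouringQ₃ n (colourCount n)
  rationalColouring n = colourOf , colourOf-proper
    where
    colourOf : (Fin n → Q₃) → Fin (colourCount n)
    colourOf x = colour n (reduce₃ ∘ x)
    colourOf-proper : ∀ x y → UnitDistQ₃ n x y → colourOf x ≢ colourOf y
    colourOf-proper x y dist≡1 eq = ¬1ℚ↦₃0 (subst₂ _↦₃_ dist≡1
      (colour-≡⇒sqDist₃≡0 n (reduce₃ ∘ x) (reduce₃ ∘ y) eq)
      (↦₃-sqDist n (proj₁ ∘ x) (proj₁ ∘ y) (reduce₃ ∘ x) (reduce₃ ∘ y)
                  (reduce₃-↦₃ ∘ x) (reduce₃-↦₃ ∘ y)))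

open import Data.Nat using (_≤_; _*_; _^_; z≤n; s≤s)
open import Data.Nat.Properties using (m≤m*n; *-monoʳ-≤; module ≤-Reasoning)
open import Data.Nat.Tactic.RingSolver using () renaming (solve-∀ to solveℕ-∀)

colourCount-cube-bound : ∀ n → colourCount n ^ 3 ≤ 3 ^ 3 * 9 ^ n
colourCount-cube-bound 0                   = s≤s z≤n
colourCount-cube-bound 1                   = m≤m*n 27 9
colourCount-cube-bound 2                   = m≤m*n 729 3
colourCount-cube-bound (suc (suc (suc n))) = begin
  (9 * colourCount n) ^ 3  ≡⟨ cube-of-9* (colourCount n) ⟩
  729 * colourCount n ^ 3  ≤⟨ *-monoʳ-≤ 729 (colourCount-cube-bound n) ⟩
  729 * (27 * 9 ^ n)       ≡⟨ regroup (9 ^ n) ⟩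
  27 * 9 ^ suc (suc (suc n)) ∎
  where
  open ≤-Reasoning
  cube-of-9* : ∀ x → (9 * x) * ((9 * x) * ((9 * x) * 1)) ≡ 729 * (x * (x * (x * 1)))
  cube-of-9* = solveℕ-∀
  regroup : ∀ y → 729 * (27 * y) ≡ 27 * (9 * (9 * (9 * y)))
  regroup = solveℕ-∀

open RationalReduction using (rationalColouring)

mainTheorem15 : Σ ℕ λ c →
    ((n : ℕ) → 1 ≤ n →
    Σ ℕ λ k → (k ^ 3 ≤ (c ^ 3) * (9 ^ n)) × ColouringQ₃ n k)
    ×
    ((R : CommutativeRing 0ℓ 0ℓ) → ArchimedeanOrdered R → RingHomToℤ₃ R →
    (n : ℕ) → 1 ≤ n →
    Σ ℕ λ k → (k ^ 3 ≤ (c ^ 3) * (9 ^ n)) × ColouringR R n k)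
mainTheorem15 =
  3 , (λ n _ → colourCount n , colourCount-cube-bound n , rationalColouring n)
    , (λ R _ h n _ → colourCount n , colourCount-cube-bound n , ringColouring R h n)
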